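{- Let $D$ be a planar digraph (drawn in the plane) of digirth at least five and $L$ a $2$-list-assignment for $D$ such that $D$ is not $L$-colorable but every proper subdigraph of $D$ is $L$-colorable. Let $v$ be a vertex incident to a triangle $T=vwu$ (a face of size $3$ of the underlying plane graph), let $\phi$ be an $L$-coloring of $D-v$, and let $i\in L(v)$. Then no directed cycle of $D$ all of whose vertices have color $i$ in the coloring obtained from $\phi$ by coloring $v$ with $i$, and which passes through $v$, contains both edges $vu$ and $vw$.
   Context: Digraphs have no directed cycles of length at most $2$; the digirth is the length of a shortest directed cycle. An edge $xy$ of $D$ means that $xy$ or $yx$ is an arc. A set of vertices is acyclic if it induces no directed cycle; for a list-assignment $L$, an $L$-coloring assigns each vertex a color from its list so that each color class is acyclic; a $2$-list-assignment has all lists of size $2$. (Since $D$ is not $L$-colorable, coloring $v$ with $i$ creates a directed cycle through $v$ all of whose vertices have color $i$; the claim concerns any such cycle.) -}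

module Defs where

open import Data.Nat using (ℕ; zero; suc; _+_; _*_; _≤_)
open import Data.Nat.DivMod using (_mod_)
open import Data.Fin using (Fin; toℕ) renaming (zero to fzero; suc to fsuc)
open import Data.Fin.Properties using (_≟_)
open import Data.Bool using (Bool; true; false; if_then_else_; _∨_; _∧_; not)
open import Data.List using (List; length)
open import Data.List.Membership.Propositional using (_∈_)
open import Data.List.Relation.Unary.Unique.Propositional using (Unique)
open import Data.Product using (Σ; ∃; _×_; _,_)
open import Data.Sum using (_⊎_)
open import Relation.Nullary using (¬_)
open import Relation.Nullary.Decidable using (⌊_⌋)
open import Relation.Binary.PropositionalEquality using (_≡_)
open import Function using (_∘_; _⇔_)
open import Function.Definitions using (Injective)

-- Digraphs: vertex set Fin n, arcs given by a Boolean adjacency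
-- function: arc x y ≡ true  iff  x → y is an arc.
-- (Loops / digons are excluded by the digirth hypothesis, which
-- forbids directed cycles of length 1 and 2.)

Adj : ℕ → Set
Adj n = Fin n → Fin n → Bool

next : ∀ {k} → Fin (suc k) → Fin (suc k)
next {k} j = suc (toℕ j) mod suc k

record DiCycle {n : ℕ} (A : Adj n) : Set where
  field
    len  : ℕ
    vtx  : Fin (suc len) → Fin n
    inj  : Injective _≡_ _≡_ vtx
    arcs : ∀ j → A (vtx j) (vtx (next j)) ≡ true
open DiCycle public

cycleLength : ∀ {n} {A : Adj n} → DiCycle A → ℕ
cycleLength C = suc (len C)

DigirthAtLeast : ∀ {n} → Adj n → ℕ → Set
DigirthAtLeast A k = (C : DiCycle A) → k ≤ cycleLength C

Monochromatic : ∀ {n} {A : Adj n} → (Fin n → ℕ) → ℕ → DiCycle A → Set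
Monochromatic c i C = ∀ j → c (vtx C j) ≡ i

PassesThrough : ∀ {n} {A : Adj n} → DiCycle A → Fin n → Set
PassesThrough C v = ∃ λ j → vtx C j ≡ v

ContainsEdge : ∀ {n} {A : Adj n} → DiCycle A → Fin n → Fin n → Set
ContainsEdge C x y =
  ∃ λ j → (vtx C j ≡ x × vtx C (next j) ≡ y) ⊎ (vtx C j ≡ y × vtx C (next j) ≡ x)

ListAssignment : ℕ → Set
ListAssignment n = Fin n → List ℕ

Is2ListAssignment : ∀ {n} → ListAssignment n → Set
Is2ListAssignment L = ∀ x → length (L x) ≡ 2 × Unique (L x)

record Subdigraph {n : ℕ} (A : Adj n) : Set where
  field
    S    : Fin n → Bool
    B    : Adj n
    sub  : ∀ x y → B x y ≡ true → (A x y ≡ true × S x ≡ true × S y ≡ true)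
open Subdigraph public

Proper : ∀ {n} {A : Adj n} → Subdigraph A → Set
Proper {n} {A} H =
  (∃ λ x → S H x ≡ false) ⊎ (∃ λ x → ∃ λ y → A x y ≡ true × B H x y ≡ false)

-- An L-colouring of a subdigraph H: colours from the lists on the
-- vertices of H, every colour class acyclic (no monochromatic directed
-- cycle of H).  Values of c outside S H are irrelevant.
IsLColoring : ∀ {n} {A : Adj n} → ListAssignment n → (H : Subdigraph A) →
              (Fin n → ℕ) → Set
IsLColoring L H c =
  (∀ x → S H x ≡ true → c x ∈ L x) ×
  ((C : DiCycle (B H)) → ∀ i → ¬ Monochromatic c i C)

LColorable : ∀ {n} {A : Adj n} → ListAssignment n → Subdigraph A → Set
LColorable L H = ∃ λ c → IsLColoring L H c

whole : ∀ {n} (A : Adj n) → Subdigraph A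
whole A = record { S = λ _ → true ; B = A ; sub = λ x y p → p , _≡_.refl , _≡_.refl }

notEq : ∀ {n} → Fin n → Fin n → Bool
notEq x v = not ⌊ x ≟ v ⌋

deleteVertex : ∀ {n} (A : Adj n) → Fin n → Subdigraph A
deleteVertex A v = record
  { S = λ x → notEq x v
  ; B = λ x y → A x y ∧ notEq x v ∧ notEq y v
  ; sub = lem }
  where
  lem : ∀ x y → (A x y ∧ notEq x v ∧ notEq y v) ≡ true →
        (A x y ≡ true × notEq x v ≡ true × notEq y v ≡ true)
  lem x y p with A x y | notEq x v | notEq y v
  lem x y _≡_.refl | true | true | true = _≡_.refl , _≡_.refl , _≡_.refl

extend : ∀ {n} → (Fin n → ℕ) → Fin n → ℕ → Fin n → ℕ
extend φ v i x = if ⌊ x ≟ v ⌋ then i else φ x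

Edge : ∀ {n} → Adj n → Fin n → Fin n → Set
Edge A x y = (A x y ∨ A y x) ≡ true

iter : ∀ {X : Set} → (X → X) → ℕ → X → X
iter f zero x = x
iter f (suc k) x = f (iter f k x)

-- ρ x is a cyclic permutation of the neighbours of x
-- (the clockwise order of the edges around x)
IsRotationSystem : ∀ {n} → Adj n → (Fin n → Fin n → Fin n) → Set
IsRotationSystem A ρ =
  (∀ x y → Edge A x y → Edge A x (ρ x y)) ×
  (∀ x y y' → Edge A x y → Edge A x y' → ρ x y ≡ ρ x y' → y ≡ y') ×
  (∀ x y y' → Edge A x y → Edge A x y' → ∃ λ k → iter (ρ x) k y ≡ y')

Dart : ℕ → Set
Dart n = Fin n × Fin n

faceMap : ∀ {n} → (Fin n → Fin n → Fin n) → Dart n → Dart n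
faceMap ρ (x , y) = y , ρ y x

SameFace : ∀ {n} → (Fin n → Fin n → Fin n) → Dart n → Dart n → Set
SameFace ρ d d' = ∃ λ k → iter (faceMap ρ) k d ≡ d'

IsDart : ∀ {n} → Adj n → Dart n → Set
IsDart A (x , y) = Edge A x y

data Connected {n : ℕ} (A : Adj n) : Fin n → Fin n → Set where
  here : ∀ {x} → Connected A x x
  step : ∀ {x y z} → Edge A x y → Connected A y z → Connected A x z

count : ∀ {n} → (Fin n → Bool) → ℕ
count {zero} p = 0
count {suc n} p = (if p fzero then 1 else 0) + count (p ∘ fsuc)

degree : ∀ {n} → Adj n → Fin n → ℕ
degree A x = count (λ y → A x y ∨ A y x)

sumF : ∀ {n} → (Fin n → ℕ) → ℕ
sumF {zero} f = 0
sumF {suc n} f = f fzero + sumF (f ∘ fsuc)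

isIsolated : ∀ {n} → Adj n → Fin n → Bool
isIsolated A x with degree A x
... | zero = true
... | suc _ = false

-- number of darts = 2 · (number of edges)
numDarts : ∀ {n} → Adj n → ℕ
numDarts A = sumF (degree A)

-- Euler's formula for the combinatorial map (A , ρ):
-- with c components, f face orbits of darts and iso isolated vertices
-- (each of which is a component with one face and no darts),
--   n − m + (f + iso) = 2c,  i.e.  2(n + f + iso) = 4c + #darts.
-- This holds iff every component has genus 0, i.e. the rotation system
-- is that of a plane embedding.
record PlaneEmbedding {n : ℕ} (A : Adj n) : Set where
  field
    ρ        : Fin n → Fin n → Fin n
    rotation : IsRotationSystem A ρ
    nComp    : ℕ
    comp     : Fin n → Fin nComp
    compSurj : ∀ j → ∃ λ x → comp x ≡ j
    compSpec : ∀ x y → (comp x ≡ comp y) ⇔ Connected A x y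
    nFaces   : ℕ
    face     : Dart n → Fin nFaces
    faceSurj : ∀ j → ∃ λ d → IsDart A d × face d ≡ j
    faceSpec : ∀ d d' → IsDart A d → IsDart A d' →
               (face d ≡ face d') ⇔ SameFace ρ d d'
    euler    : 2 * (n + nFaces + count (isIsolated A)) ≡ 4 * nComp + numDarts A
open PlaneEmbedding public

TriangularFace : ∀ {n} {A : Adj n} → PlaneEmbedding A → Fin n → Fin n → Fin n → Set
TriangularFace {A = A} E v w u =
  IsDart A (v , w) ×
  faceMap (ρ E) (v , w) ≡ (w , u) ×
  faceMap (ρ E) (w , u) ≡ (u , v) ×
  faceMap (ρ E) (u , v) ≡ (v , w)

-- If the cycle enters v from x and leaves it towards y, the triangle face makes {u, w} = {x, y}
-- and x, y adjacent.  An arc y → x would close the directed triangle x v y, against digirth ≥ 5;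
-- an arc x → y would shortcut the cycle past v, giving a cycle of D − v that is monochromatic
-- under φ, against φ being an L-colouring of D − v.
module Submission where

open import Defs
open import Data.Nat using (ℕ; zero; suc; _≤_; s≤s; z≤n)
open import Data.Nat.Properties using (≤-trans; n≤1+n)
open import Data.Nat.DivMod using (_%_; m<n⇒m%n≡m; n%n≡0)
open import Data.Fin using (Fin; toℕ; fromℕ; inject₁) renaming (zero to fzero; suc to fsuc)
open import Data.Fin.Properties
  using (toℕ-fromℕ<; toℕ-fromℕ; toℕ-inject₁; toℕ-injective; toℕ<n; suc-injective)
  renaming (_≟_ to _≟ᶠ_)
open import Data.Fin.Induction using (<-weakInduction)
open import Data.Fin.Relation.Unary.Top using (view; ‵fromℕ; ‵inject₁)
open import Data.Bool using (true; false; not; _∧_; if_then_else_)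
open import Data.Bool.Properties using (∨-comm; ∨-idem; ∧-identityʳ)
open import Data.List.Membership.Propositional using (_∈_)
open import Data.Product using (Σ; ∃; _×_; _,_; proj₁; proj₂)
open import Data.Sum using (_⊎_; inj₁; inj₂)
open import Data.Empty using (⊥)
open import Relation.Nullary using (¬_; yes; no)
open import Relation.Nullary.Decidable using (⌊_⌋; isYes≗does; dec-false)
open import Relation.Binary.PropositionalEquality
  using (_≡_; _≢_; refl; sym; trans; cong; subst; module ≡-Reasoning)
open import Function using (_∘_)
open import Function.Definitions using (Injective)

iter-commute : ∀ {X : Set} (f : X → X) t x → iter f t (f x) ≡ f (iter f t x)
iter-commute f zero    x = refl
iter-commute f (suc t) x = cong f (iter-commute f t x)

iter-injective : ∀ {X : Set} {f : X → X} → Injective _≡_ _≡_ f → ∀ t → Injective _≡_ _≡_ (iter f t)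
iter-injective f-inj zero    e = e
iter-injective f-inj (suc t) e = iter-injective f-inj t (f-inj e)

next-fromℕ : ∀ k → next (fromℕ k) ≡ fzero
next-fromℕ k = toℕ-injective (begin
  toℕ (next (fromℕ k))        ≡⟨ toℕ-fromℕ< _ ⟩
  suc (toℕ (fromℕ k)) % suc k ≡⟨ cong (λ m → suc m % suc k) (toℕ-fromℕ k) ⟩
  suc k % suc k               ≡⟨ n%n≡0 (suc k) ⟩
  0                           ∎)
  where open ≡-Reasoning

next-inject₁ : ∀ {k} (j : Fin k) → next (inject₁ j) ≡ fsuc j
next-inject₁ {k} j = toℕ-injective (begin
  toℕ (next (inject₁ j))        ≡⟨ toℕ-fromℕ< _ ⟩
  suc (toℕ (inject₁ j)) % suc k ≡⟨ cong (λ m → suc m % suc k) (toℕ-inject₁ j) ⟩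
  suc (toℕ j) % suc k           ≡⟨ m<n⇒m%n≡m (s≤s (toℕ<n j)) ⟩
  suc (toℕ j)                   ∎)
  where open ≡-Reasoning

next-injective : ∀ {k} → Injective _≡_ _≡_ (next {k})
next-injective {k} {i} {j} e with view i | view j
... | ‵fromℕ      | ‵fromℕ      = refl
... | ‵fromℕ      | ‵inject₁ j′ with () ← trans (sym (next-fromℕ k)) (trans e (next-inject₁ j′))
... | ‵inject₁ i′ | ‵fromℕ      with () ← trans (sym (next-inject₁ i′)) (trans e (next-fromℕ k))
... | ‵inject₁ i′ | ‵inject₁ j′ =
  cong inject₁ (suc-injective (trans (sym (next-inject₁ i′)) (trans e (next-inject₁ j′))))

iter-next-fzero : ∀ {k} (p : Fin (suc k)) → iter next (toℕ p) fzero ≡ p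
iter-next-fzero = <-weakInduction (λ p → iter next (toℕ p) fzero ≡ p) refl next-preserves
  where
  open ≡-Reasoning
  next-preserves : ∀ i → iter next (toℕ (inject₁ i)) fzero ≡ inject₁ i → next (iter next (toℕ i) fzero) ≡ fsuc i
  next-preserves i hyp = begin
    next (iter next (toℕ i) fzero)             ≡⟨ cong (λ m → next (iter next m fzero)) (sym (toℕ-inject₁ i)) ⟩
    next (iter next (toℕ (inject₁ i)) fzero)   ≡⟨ cong next hyp ⟩
    next (inject₁ i)                           ≡⟨ next-inject₁ i ⟩
    fsuc i                                     ∎

module _ {n : ℕ} {A : Adj n} where

  edge-sym : ∀ {x y} → Edge A x y → Edge A y x
  edge-sym {x} {y} e = trans (∨-comm (A y x) (A x y)) e

  arc-or-reverse : ∀ {x y} → Edge A x y → A x y ≡ true ⊎ A y x ≡ true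
  arc-or-reverse {x} {y} e with A x y
  ... | true  = inj₁ refl
  ... | false = inj₂ e

  digirth-mono : ∀ {k m} → k ≤ m → DigirthAtLeast A m → DigirthAtLeast A k
  digirth-mono k≤m dg C = ≤-trans k≤m (dg C)

  loop : ∀ x → A x x ≡ true → DiCycle A
  loop x a = record
    { len = 0 ; vtx = λ _ → x ; inj = λ { {fzero} {fzero} _ → refl } ; arcs = λ { fzero → a } }

  directedTriangle : ∀ {x y z} → A x y ≡ true → A y z ≡ true → A z x ≡ true →
                     x ≢ y → y ≢ z → z ≢ x → DiCycle A
  directedTriangle {x} {y} {z} xy yz zx x≢y y≢z z≢x =
    record { len = 2 ; vtx = corner ; inj = corner-injective ; arcs = side }
    where
    corner : Fin 3 → Fin n
    corner fzero               = x
    corner (fsuc fzero)        = y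
    corner (fsuc (fsuc fzero)) = z
    corner-injective : Injective _≡_ _≡_ corner
    corner-injective {fzero}               {fzero}               _ = refl
    corner-injective {fzero}               {fsuc fzero}          e with () ← x≢y e
    corner-injective {fzero}               {fsuc (fsuc fzero)}   e with () ← z≢x (sym e)
    corner-injective {fsuc fzero}          {fzero}               e with () ← x≢y (sym e)
    corner-injective {fsuc fzero}          {fsuc fzero}          _ = refl
    corner-injective {fsuc fzero}          {fsuc (fsuc fzero)}   e with () ← y≢z e
    corner-injective {fsuc (fsuc fzero)}   {fzero}               e with () ← z≢x e
    corner-injective {fsuc (fsuc fzero)}   {fsuc fzero}          e with () ← y≢z (sym e)
    corner-injective {fsuc (fsuc fzero)}   {fsuc (fsuc fzero)}   _ = refl
    side : ∀ j → A (corner j) (corner (next j)) ≡ true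
    side fzero               = xy
    side (fsuc fzero)        = yz
    side (fsuc (fsuc fzero)) = zx

  loopless : ∀ {k} → DigirthAtLeast A (suc (suc k)) → ∀ x → A x x ≢ true
  loopless dg x a with dg (loop x a)
  ... | s≤s ()

  -- Two coincident corners of a closed 3-walk would give a loop.
  no-closed-3-walk : DigirthAtLeast A 4 → ∀ {x y z} →
                     A x y ≡ true → A y z ≡ true → A z x ≡ true → ⊥
  no-closed-3-walk dg {x} {y} {z} xy yz zx with x ≟ᶠ y | y ≟ᶠ z | z ≟ᶠ x
  ... | yes refl | _        | _        = loopless dg x xy
  ... | no _     | yes refl | _        = loopless dg y yz
  ... | no _     | no _     | yes refl = loopless dg z zx
  ... | no x≢y   | no y≢z   | no z≢x   with dg (directedTriangle xy yz zx x≢y y≢z z≢x)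
  ...   | s≤s (s≤s (s≤s ()))

  rotate : (C : DiCycle A) → Fin (suc (len C)) → DiCycle A
  rotate C p = record
    { len  = len C
    ; vtx  = vtx C ∘ iter next (toℕ p)
    ; inj  = iter-injective next-injective (toℕ p) ∘ inj C
    ; arcs = λ j → subst (λ k → A (vtx C (iter next (toℕ p) j)) (vtx C k) ≡ true)
                         (sym (iter-commute next (toℕ p) j)) (arcs C (iter next (toℕ p) j)) }

  rotate-fzero : ∀ C p → vtx (rotate C p) fzero ≡ vtx C p
  rotate-fzero C p = cong (vtx C) (iter-next-fzero p)

  Consecutive : DiCycle A → Fin n → Fin n → Set
  Consecutive C x y = ∃ λ j → vtx C j ≡ x × vtx C (next j) ≡ y

  Consecutive-rotate : ∀ C p {x y} → Consecutive (rotate C p) x y → Consecutive C x y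
  Consecutive-rotate C p (j , x≡ , y≡) =
    iter next (toℕ p) j , x≡ , trans (cong (vtx C) (sym (iter-commute next (toℕ p) j))) y≡

  Consecutive-last-first : ∀ C → Consecutive C (vtx C (fromℕ (len C))) (vtx C fzero)
  Consecutive-last-first C = fromℕ (len C) , refl , cong (vtx C) (next-fromℕ (len C))

  Consecutive-first-second : ∀ C → Consecutive C (vtx C fzero) (vtx C (next fzero))
  Consecutive-first-second C = fzero , refl , refl

  successor-unique : ∀ C {x y y′} → Consecutive C x y → Consecutive C x y′ → y ≡ y′
  successor-unique C (j , refl , refl) (j′ , x≡ , refl) = cong (vtx C ∘ next) (inj C (sym x≡))

  predecessor-unique : ∀ C {x x′ y} → Consecutive C x y → Consecutive C x′ y → x ≡ x′
  predecessor-unique C (j , refl , refl) (j′ , refl , y≡) =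
    cong (vtx C) (next-injective (inj C (sym y≡)))

  ContainsEdge-neighbour : ∀ C {x v y u} → ContainsEdge C v u →
                           Consecutive C x v → Consecutive C v y → u ≡ x ⊎ u ≡ y
  ContainsEdge-neighbour C (j , inj₁ (v≡ , u≡)) _  vy = inj₂ (successor-unique C (j , v≡ , u≡) vy)
  ContainsEdge-neighbour C (j , inj₂ (u≡ , v≡)) xv _  = inj₁ (predecessor-unique C (j , u≡ , v≡) xv)

  skipFirst : (C : DiCycle A) → 2 ≤ cycleLength C →
              A (vtx C (fromℕ (len C))) (vtx C (next fzero)) ≡ true →
              Σ (DiCycle A) λ C′ → ∀ j → ∃ λ k → vtx C′ j ≡ vtx C (fsuc k)
  skipFirst record { len = zero } (s≤s ())
  skipFirst C@record { len = suc l ; vtx = f } _ chord =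
    record { len = l ; vtx = f ∘ fsuc ; inj = suc-injective ∘ inj C ; arcs = arc } , λ j → j , refl
    where
    arc : ∀ j → A (f (fsuc j)) (f (fsuc (next j))) ≡ true
    arc j with view j
    ... | ‵fromℕ      rewrite next-fromℕ l = subst (λ k → A (f (fromℕ (suc l))) (f k) ≡ true)
                                                   (next-inject₁ fzero) chord
    ... | ‵inject₁ j′ rewrite next-inject₁ j′ = subst (λ k → A (f (fsuc (inject₁ j′))) (f k) ≡ true)
                                                      (next-inject₁ (fsuc j′)) (arcs C (fsuc (inject₁ j′)))

  ⌊≟⌋-≢ : ∀ {x v : Fin n} → x ≢ v → ⌊ x ≟ᶠ v ⌋ ≡ false
  ⌊≟⌋-≢ {x} {v} x≢v = trans (isYes≗does (x ≟ᶠ v)) (dec-false (x ≟ᶠ v) x≢v)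

  notEq-≢ : ∀ {x v : Fin n} → x ≢ v → notEq x v ≡ true
  notEq-≢ x≢v = cong not (⌊≟⌋-≢ x≢v)

  extend-≢ : ∀ (φ : Fin n → ℕ) i {x v : Fin n} → x ≢ v → extend φ v i x ≡ φ x
  extend-≢ φ i {x} x≢v = cong (if_then i else φ x) (⌊≟⌋-≢ x≢v)

  avoiding⇒deleteVertex : ∀ {v} (C : DiCycle A) → (∀ j → vtx C j ≢ v) → DiCycle (B (deleteVertex A v))
  avoiding⇒deleteVertex {v} C avoids = record
    { len = len C ; vtx = vtx C ; inj = inj C ; arcs = arc }
    where
    arc : ∀ j → (A (vtx C j) (vtx C (next j)) ∧ notEq (vtx C j) v ∧ notEq (vtx C (next j)) v) ≡ true
    arc j rewrite notEq-≢ (avoids j) | notEq-≢ (avoids (next j)) =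
      trans (∧-identityʳ _) (arcs C j)

  neighbours-of-first-nonadjacent :
    DigirthAtLeast A 4 → ∀ {v} (φ : Fin n → ℕ) i →
    ((C : DiCycle (B (deleteVertex A v))) → ¬ Monochromatic φ i C) →
    (C : DiCycle A) → vtx C fzero ≡ v → Monochromatic (extend φ v i) i C →
    ¬ Edge A (vtx C (fromℕ (len C))) (vtx C (next fzero))
  neighbours-of-first-nonadjacent dg {v} φ i φ-acyclic C refl mono e with arc-or-reverse e
  ... | inj₂ yx = no-closed-3-walk dg yx
                    (subst (λ k → A (vtx C (fromℕ (len C))) (vtx C k) ≡ true) (next-fromℕ (len C))
                           (arcs C (fromℕ (len C))))
                    (arcs C fzero)
  ... | inj₁ xy with skipFirst C (≤-trans (s≤s (s≤s z≤n)) (dg C)) xy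
  ...   | C′ , ⊆C = φ-acyclic (avoiding⇒deleteVertex C′ avoids) coloured
    where
    avoids : ∀ j → vtx C′ j ≢ v
    avoids j e with ⊆C j
    ... | k , e′ with () ← inj C (trans (sym e′) e)
    coloured : Monochromatic φ i (avoiding⇒deleteVertex C′ avoids)
    coloured j with ⊆C j
    ... | k , e′ =
      trans (sym (extend-≢ φ i (avoids j))) (trans (cong (extend φ v i) e′) (mono (fsuc k)))

  edge-between-neighbours : ∀ {k} → DigirthAtLeast A (suc (suc k)) → ∀ {x y u w} →
                            u ≡ x ⊎ u ≡ y → w ≡ x ⊎ w ≡ y → Edge A w u → Edge A x y
  edge-between-neighbours dg {x} (inj₁ refl) (inj₁ refl) e
    with () ← loopless dg x (trans (sym (∨-idem _)) e)
  edge-between-neighbours dg {y = y} (inj₂ refl) (inj₂ refl) e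
    with () ← loopless dg y (trans (sym (∨-idem _)) e)
  edge-between-neighbours dg (inj₁ refl) (inj₂ refl) e = edge-sym e
  edge-between-neighbours dg (inj₂ refl) (inj₁ refl) e = e

  triangularFace-edge : (E : PlaneEmbedding A) → ∀ {v w u} → TriangularFace E v w u → Edge A w u
  triangularFace-edge E {v} {w} (vw , vw↦wu , _) =
    subst (Edge A w) (cong proj₂ vw↦wu) (proj₁ (rotation E) w v (edge-sym vw))

lemma3p2 : (n : ℕ) (A : Adj n) (E : PlaneEmbedding A) (L : ListAssignment n) →
           DigirthAtLeast A 5 →
           Is2ListAssignment L →
           ¬ LColorable L (whole A) →
           ((H : Subdigraph A) → Proper H → LColorable L H) →
           (v w u : Fin n) → TriangularFace E v w u →
           (φ : Fin n → ℕ) → IsLColoring L (deleteVertex A v) φ →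
           (i : ℕ) → i ∈ L v →
           (C : DiCycle A) → Monochromatic (extend φ v i) i C → PassesThrough C v →
           ¬ (ContainsEdge C v u × ContainsEdge C v w)
lemma3p2 n A E L dg _ _ _ v w u face φ (_ , φ-acyclic) i _ C mono (p , vp) (vu , vw) =
  neighbours-of-first-nonadjacent dg₄ φ i (λ C″ → φ-acyclic C″ i) C′ v-first (mono ∘ iter next (toℕ p))
    (edge-between-neighbours dg
      (ContainsEdge-neighbour C vu xv vy) (ContainsEdge-neighbour C vw xv vy)
      (triangularFace-edge E face))
  where
  dg₄ : DigirthAtLeast A 4
  dg₄ = digirth-mono (n≤1+n 4) dg
  C′ : DiCycle A
  C′ = rotate C p
  v-first : vtx C′ fzero ≡ v
  v-first = trans (rotate-fzero C p) vp
  xv : Consecutive C (vtx C′ (fromℕ (len C))) v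
  xv = Consecutive-rotate C p (subst (Consecutive C′ _) v-first (Consecutive-last-first C′))
  vy : Consecutive C v (vtx C′ (next fzero))
  vy = Consecutive-rotate C p (subst (λ z → Consecutive C′ z _) v-first (Consecutive-first-second C′))
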